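{- Let $k\ge 1$ and let $G$ be a $k$-connected simple graph on the vertex set $\{1,\dots,\ell\}$, and let $K_\ell$ be the complete graph on $\{1,\dots,\ell\}$. Then $$\bigoplus_{j<k} D(\mathcal{A}(G))_j=\bigoplus_{j<k} D(\mathcal{A}(K_\ell))_j,$$ i.e. the homogeneous derivations of polynomial degree smaller than $k$ in $D(\mathcal{A}(G))$ are exactly those in $D(\mathcal{A}(K_\ell))$.
   Context: Let $\mathbb{K}$ be a field and $S=\mathbb{K}[x_1,\dots,x_\ell]$. For a finite simple undirected graph $G=(V,E)$ with $V=\{1,\dots,\ell\}$, $\mathcal{A}(G)=\{\ker(x_i-x_j):\{i,j\}\in E\}$. With $D_i=\partial/\partial x_i$, $D(\mathcal{A}(G))=\{\theta\in\mathrm{Der}_{\mathbb{K}}(S):\theta(x_i-x_j)\in(x_i-x_j)S\text{ for all }\{i,j\}\in E\}$. A derivation $\theta=\sum_k f_kD_k$ is homogeneous of polynomial degree $p$ if every $f_k$ is homogeneous of degree $p$ or zero; $D(\mathcal{A}(G))_p$ denotes the $\mathbb{K}$-vector space consisting of $0$ and the elements of $D(\mathcal{A}(G))$ homogeneous of polynomial degree $p$. A graph is $k$-connected if it has more than $k$ vertices and remains connected after deleting any set of fewer than $k$ vertices. -}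

module Defs where

open import Level using (Level; _⊔_; suc)
open import Algebra.Bundles using (CommutativeRing)
open import Data.Nat as ℕ using (ℕ; _<_)
open import Data.Fin as Fin using (Fin)
open import Data.Fin.Subset using (Subset; _∈_; _∉_; ∣_∣)
open import Data.Vec as Vec using (Vec; lookup; tabulate; replicate)
open import Data.Vec.Properties using (≡-dec)
open import Data.List as List using (List; []; _∷_; _++_; map; concatMap)
open import Data.Product using (Σ; ∃; ∃-syntax; _×_; _,_)
open import Relation.Nullary using (¬_; yes; no)
open import Relation.Binary.PropositionalEquality using (_≡_; _≢_)

record Field (c ℓ : Level) : Set (suc (c ⊔ ℓ)) where
  field
    commutativeRing : CommutativeRing c ℓ
  open CommutativeRing commutativeRing public
  field
    1≉0     : ¬ (1# ≈ 0#)
    inverse : ∀ x → ¬ (x ≈ 0#) → ∃[ y ] (x * y ≈ 1#)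

-- Finite simple undirected graphs on the vertex set Fin n
-- (vertex i stands for vertex i+1 of {1,…,n}).

record Graph (n : ℕ) : Set₁ where
  field
    Adj     : Fin n → Fin n → Set
    symmetric   : ∀ {i j} → Adj i j → Adj j i
    irreflexive : ∀ {i} → ¬ Adj i i
open Graph public

complete : (n : ℕ) → Graph n
complete n = record
  { Adj = λ i j → i ≢ j
  ; symmetric = λ i≢j j≡i → i≢j (Relation.Binary.PropositionalEquality.sym j≡i)
  ; irreflexive = λ i≢i → i≢i Relation.Binary.PropositionalEquality.refl
  }

data WalkAvoiding {n : ℕ} (G : Graph n) (X : Subset n) : Fin n → Fin n → Set where
  stay : ∀ {u} → u ∉ X → WalkAvoiding G X u u
  step : ∀ {u w v} → u ∉ X → Adj G u w → WalkAvoiding G X w v → WalkAvoiding G X u v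

ConnectedAfterDeleting : {n : ℕ} → Graph n → Subset n → Set
ConnectedAfterDeleting G X = ∀ u v → u ∉ X → v ∉ X → WalkAvoiding G X u v

KConnected : {n : ℕ} → ℕ → Graph n → Set
KConnected {n} k G = (k < n) × (∀ (X : Subset n) → ∣ X ∣ < k → ConnectedAfterDeleting G X)

module Poly {c ℓ' : Level} (𝕂 : Field c ℓ') (n : ℕ) where
  open Field 𝕂

  Monomial : Set
  Monomial = Vec ℕ n

  degree : Monomial → ℕ
  degree = Vec.foldr _ ℕ._+_ 0

  -- a polynomial is a finite formal sum of terms c · x^m
  Poly : Set c
  Poly = List (Carrier × Monomial)

  coeff : Poly → Monomial → Carrier
  coeff []             m = 0#
  coeff ((a , m') ∷ p) m with ≡-dec ℕ._≟_ m' m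
  ... | yes _ = a + coeff p m
  ... | no  _ = coeff p m

  _≈ₚ_ : Poly → Poly → Set ℓ'
  p ≈ₚ q = ∀ m → coeff p m ≈ coeff q m

  0ₚ : Poly
  0ₚ = []

  _+ₚ_ : Poly → Poly → Poly
  _+ₚ_ = _++_

  -ₚ_ : Poly → Poly
  -ₚ_ = map (λ { (a , m) → (- a , m) })

  _-ₚ_ : Poly → Poly → Poly
  p -ₚ q = p +ₚ (-ₚ q)

  _*ₚ_ : Poly → Poly → Poly
  p *ₚ q = concatMap (λ { (a , m) → map (λ { (b , m') → (a * b , Vec.zipWith ℕ._+_ m m') }) q }) p

  var : Fin n → Poly
  var i = (1# , tabulate (λ j → indicator i j)) ∷ []
    where
    indicator : Fin n → Fin n → ℕ
    indicator i j with i Fin.≟ j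
    ... | yes _ = 1
    ... | no  _ = 0

  _∣ₚ_ : Poly → Poly → Set (c ⊔ ℓ')
  f ∣ₚ g = ∃[ h ] (g ≈ₚ (f *ₚ h))

  HomogeneousPoly : ℕ → Poly → Set ℓ'
  HomogeneousPoly d f = ∀ m → degree m ≢ d → coeff f m ≈ 0#

  -- a derivation θ = Σ_k f_k D_k of S, given by its coefficients f_k = θ(x_k)
  Derivation : Set c
  Derivation = Fin n → Poly

  applyDiff : Derivation → Fin n → Fin n → Poly
  applyDiff θ i j = θ i -ₚ θ j

  InD : Graph n → Derivation → Set (c ⊔ ℓ')
  InD G θ = ∀ i j → Adj G i j → (var i -ₚ var j) ∣ₚ applyDiff θ i j

  HomogeneousDer : ℕ → Derivation → Set ℓ'
  HomogeneousDer d θ = ∀ k → HomogeneousPoly d (θ k)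

{-# OPTIONS --safe #-}
module Submission where

-- Let θ ∈ D(𝒜(G)) be homogeneous of degree p < k and i ≠ j. Then x_i − x_j divides
-- f = θ_i − θ_j as soon as g, the result of substituting x_j for x_i in f, is zero.
-- For a vertex set Y ∌ j let c_Y substitute x_j for every variable outside Y. If
-- ∣Y∣ ≤ p then G − (Y − i) is connected, and c_Y(g) is f with every variable outside
-- Y − i replaced by x_j. That substitution kills θ_a − θ_b for every edge ab of
-- G − (Y − i), so following a walk from i to j gives c_Y(g) = 0. Finally a homogeneous
-- g of degree p with c_Y(g) = 0 for all such Y vanishes: for a monomial m of degree p put
-- Y = supp m − j. Then c_Y fixes m and every other monomial it sends to m has a smaller
-- exponent of x_j, so induction on that exponent shows that the coefficient of m is zero.

open import Defs
open import Level using (Level; 0ℓ)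
open import Data.Bool.Base using (true; false; if_then_else_; _∧_; not)
open import Data.Fin.Base using (Fin; zero; suc)
open import Data.Fin.Properties using (_≟_)
open import Data.Fin.Subset using (Subset; inside; outside; _∈_; _∉_; _─_; ⁅_⁆; ∣_∣)
open import Data.Fin.Subset.Properties using (_∈?_; x∈p∧x≢y⇒x∈p-y; ∣p─q∣≤∣p∣; p─q⊆p)
open import Data.List.Base as List using ([]; _∷_; _++_)
open import Data.Nat.Base as ℕ using (ℕ; zero; suc; _≤_; _<_; _≥_; z≤n; s≤s)
import Data.Nat.Properties as ℕ
open import Data.Product.Base as Product using (_×_; _,_)
open import Data.Vec.Base as Vec using (Vec; []; _∷_; lookup; tabulate; here; there)
open import Data.Vec.Properties
  using (≡-dec; lookup∘tabulate; tabulate∘lookup; tabulate-cong; lookup-zipWith;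
         lookup∘updateAt; lookup∘updateAt′)
open import Function.Base using (_∘_; _∋_)
open import Function.Bundles using (_⇔_; mk⇔)
open import Relation.Binary.Definitions using (DecidableEquality)
open import Relation.Binary.PropositionalEquality as ≡ using (_≡_; _≢_; _≗_; cong; cong₂; ≢-sym)
open import Relation.Nullary.Decidable using (does; yes; no; does-⇔; dec-true; dec-false)
open import Relation.Nullary.Negation using (contradiction)
open import Relation.Unary using (Pred; Decidable; _≐_; _∩_)
open import Relation.Unary.Properties using (_∩?_; ∁?)

module Exponents where
  open import Data.Nat.Base using (_+_; _*_)
  open import Algebra.Properties.CommutativeMonoid.Sum ℕ.+-0-commutativeMonoid
    using (sum; sum-syntax; sum-cong-≗; ∑-distrib-+; ∑-comm; sum-replicate-zero)
  open import Algebra.Properties.CommutativeSemigroup ℕ.+-commutativeSemigroup using (x∙yz≈y∙xz)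
  open ≡.≡-Reasoning

  δ : ∀ {n} → Fin n → Fin n → ℕ
  δ u v = if does (u ≟ v) then 1 else 0

  δ-refl : ∀ {n} (u : Fin n) → δ u u ≡ 1
  δ-refl u = cong (if_then 1 else 0) (dec-true (u ≟ u) ≡.refl)

  δ-≢ : ∀ {n} {u v : Fin n} → u ≢ v → δ u v ≡ 0
  δ-≢ {u = u} {v} u≢v = cong (if_then 1 else 0) (dec-false (u ≟ v) u≢v)

  δ-sym : ∀ {n} (u v : Fin n) → δ u v ≡ δ v u
  δ-sym u v = cong (if_then 1 else 0) (does-⇔ (mk⇔ ≡.sym ≡.sym) (u ≟ v) (v ≟ u))

  ∑-δ : ∀ {n} (a : Fin n) (h : Fin n → ℕ) → ∑[ u < n ] (δ a u * h u) ≡ h a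
  ∑-δ {suc n} zero    h = begin
    h zero + 0 + ∑[ u < n ] 0  ≡⟨ cong₂ _+_ (ℕ.+-identityʳ (h zero)) (sum-replicate-zero n) ⟩
    h zero + 0                 ≡⟨ ℕ.+-identityʳ (h zero) ⟩
    h zero                     ∎
  ∑-δ {suc n} (suc a) h = ∑-δ a (h ∘ suc)

  ∑-isolate : ∀ {n} (h : Fin n → ℕ) a → sum h ≡ h a + ∑[ u < n ] (if does (a ≟ u) then 0 else h u)
  ∑-isolate {suc n} h zero    = ≡.refl
  ∑-isolate {suc n} h (suc a) = begin
    h zero + sum (h ∘ suc)    ≡⟨ cong (h zero +_) (∑-isolate (h ∘ suc) a) ⟩
    h zero + (h (suc a) + r)  ≡⟨ x∙yz≈y∙xz (h zero) (h (suc a)) r ⟩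
    h (suc a) + (h zero + r)  ∎
    where
    r : ℕ
    r = ∑[ u < n ] (if does (a ≟ u) then 0 else h (suc u))

  ∑≡0⇒≡0 : ∀ {n} (h : Fin n → ℕ) → sum h ≡ 0 → ∀ u → h u ≡ 0
  ∑≡0⇒≡0 h ∑h≡0 zero    = ℕ.m+n≡0⇒m≡0 (h zero) ∑h≡0
  ∑≡0⇒≡0 h ∑h≡0 (suc u) = ∑≡0⇒≡0 (h ∘ suc) (ℕ.m+n≡0⇒n≡0 (h zero) ∑h≡0) u

  lookup-ext : ∀ {A : Set} {n} {xs ys : Vec A n} → lookup xs ≗ lookup ys → xs ≡ ys
  lookup-ext {xs = xs} {ys} xs≗ys = begin
    xs                    ≡⟨ tabulate∘lookup xs ⟨
    tabulate (lookup xs)  ≡⟨ tabulate-cong xs≗ys ⟩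
    tabulate (lookup ys)  ≡⟨ tabulate∘lookup ys ⟩
    ys                    ∎

  infixl 6 _+ᵐ_
  _+ᵐ_ : ∀ {n} → Vec ℕ n → Vec ℕ n → Vec ℕ n
  _+ᵐ_ = Vec.zipWith _+_

  unit : ∀ {n} → Fin n → Vec ℕ n
  unit a = tabulate (δ a)

  lookup-unit : ∀ {n} (a v : Fin n) → lookup (unit a) v ≡ δ a v
  lookup-unit a = lookup∘tabulate (δ a)

  -- renameᵐ π m is the exponent vector of x^m after the substitution x_u ↦ x_(π u).
  renameᵐ : ∀ {m n} → (Fin m → Fin n) → Vec ℕ m → Vec ℕ n
  renameᵐ {m} π xs = tabulate λ v → ∑[ u < m ] (δ (π u) v * lookup xs u)

  module _ {m n} (π : Fin m → Fin n) where

    lookup-renameᵐ : ∀ xs v → lookup (renameᵐ π xs) v ≡ ∑[ u < m ] (δ (π u) v * lookup xs u)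
    lookup-renameᵐ xs = lookup∘tabulate _

    renameᵐ-+ : ∀ xs ys → renameᵐ π (xs +ᵐ ys) ≡ renameᵐ π xs +ᵐ renameᵐ π ys
    renameᵐ-+ xs ys = lookup-ext λ v → begin
      lookup (renameᵐ π (xs +ᵐ ys)) v
        ≡⟨ lookup-renameᵐ (xs +ᵐ ys) v ⟩
      ∑[ u < m ] (δ (π u) v * lookup (xs +ᵐ ys) u)
        ≡⟨ sum-cong-≗ (distrib v) ⟩
      ∑[ u < m ] (δ (π u) v * lookup xs u + δ (π u) v * lookup ys u)
        ≡⟨ ∑-distrib-+ (λ u → δ (π u) v * lookup xs u) (λ u → δ (π u) v * lookup ys u) ⟩
      ∑[ u < m ] (δ (π u) v * lookup xs u) + ∑[ u < m ] (δ (π u) v * lookup ys u)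
        ≡⟨ cong₂ _+_ (lookup-renameᵐ xs v) (lookup-renameᵐ ys v) ⟨
      lookup (renameᵐ π xs) v + lookup (renameᵐ π ys) v
        ≡⟨ lookup-zipWith _+_ v (renameᵐ π xs) (renameᵐ π ys) ⟨
      lookup (renameᵐ π xs +ᵐ renameᵐ π ys) v
        ∎
      where
      distrib : ∀ v u → δ (π u) v * lookup (xs +ᵐ ys) u ≡ δ (π u) v * lookup xs u + δ (π u) v * lookup ys u
      distrib v u = ≡.trans (cong (δ (π u) v *_) (lookup-zipWith _+_ u xs ys))
                            (ℕ.*-distribˡ-+ (δ (π u) v) (lookup xs u) (lookup ys u))

    renameᵐ-unit : ∀ a → renameᵐ π (unit a) ≡ unit (π a)
    renameᵐ-unit a = lookup-ext λ v → begin
      lookup (renameᵐ π (unit a)) v               ≡⟨ lookup-renameᵐ (unit a) v ⟩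
      ∑[ u < m ] (δ (π u) v * lookup (unit a) u)  ≡⟨ sum-cong-≗ (swap v) ⟩
      ∑[ u < m ] (δ a u * δ (π u) v)              ≡⟨ ∑-δ a (λ u → δ (π u) v) ⟩
      δ (π a) v                                   ≡⟨ lookup-unit (π a) v ⟨
      lookup (unit (π a)) v                       ∎
      where
      swap : ∀ v u → δ (π u) v * lookup (unit a) u ≡ δ a u * δ (π u) v
      swap v u = ≡.trans (cong (δ (π u) v *_) (lookup-unit a u)) (ℕ.*-comm (δ (π u) v) (δ a u))

    renameᵐ-unit-+ : ∀ a xs → renameᵐ π (unit a +ᵐ xs) ≡ unit (π a) +ᵐ renameᵐ π xs
    renameᵐ-unit-+ a xs = ≡.trans (renameᵐ-+ (unit a) xs) (cong (_+ᵐ renameᵐ π xs) (renameᵐ-unit a))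

  sum≡∑lookup : ∀ {n} (xs : Vec ℕ n) → Vec.sum xs ≡ sum (lookup xs)
  sum≡∑lookup []       = ≡.refl
  sum≡∑lookup (x ∷ xs) = cong (x +_) (sum≡∑lookup xs)

  sum-renameᵐ : ∀ {m n} (π : Fin m → Fin n) xs → Vec.sum (renameᵐ π xs) ≡ Vec.sum xs
  sum-renameᵐ {m} {n} π xs = begin
    Vec.sum (renameᵐ π xs)                           ≡⟨ sum≡∑lookup (renameᵐ π xs) ⟩
    ∑[ v < n ] lookup (renameᵐ π xs) v               ≡⟨ sum-cong-≗ (lookup-renameᵐ π xs) ⟩
    ∑[ v < n ] ∑[ u < m ] (δ (π u) v * lookup xs u)  ≡⟨ ∑-comm (λ v u → δ (π u) v * lookup xs u) ⟩
    ∑[ u < m ] ∑[ v < n ] (δ (π u) v * lookup xs u)  ≡⟨ sum-cong-≗ (λ u → ∑-δ (π u) (λ _ → lookup xs u)) ⟩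
    ∑[ u < m ] lookup xs u                           ≡⟨ sum≡∑lookup xs ⟨
    Vec.sum xs                                       ∎

  renameᵐ-fixes : ∀ {n} (π : Fin n → Fin n) xs →
                  (∀ u → lookup xs u ≢ 0 → π u ≡ u) → renameᵐ π xs ≡ xs
  renameᵐ-fixes {n} π xs fixes = lookup-ext λ v → begin
    lookup (renameᵐ π xs) v               ≡⟨ lookup-renameᵐ π xs v ⟩
    ∑[ u < n ] (δ (π u) v * lookup xs u)  ≡⟨ sum-cong-≗ (on-support v) ⟩
    ∑[ u < n ] (δ v u * lookup xs u)      ≡⟨ ∑-δ v (lookup xs) ⟩
    lookup xs v                           ∎
    where
    on-support : ∀ v u → δ (π u) v * lookup xs u ≡ δ v u * lookup xs u
    on-support v u with lookup xs u ℕ.≟ 0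
    ... | yes xsᵤ≡0 rewrite xsᵤ≡0 = ≡.trans (ℕ.*-zeroʳ (δ (π u) v)) (≡.sym (ℕ.*-zeroʳ (δ v u)))
    ... | no  xsᵤ≢0 = cong (_* lookup xs u) (≡.trans (cong (λ w → δ w v) (fixes u xsᵤ≢0)) (δ-sym u v))

  collapse : ∀ {n} → Fin n → Subset n → Fin n → Fin n
  collapse j Y v = if does (v ∈? Y) then v else j

  collapse-∈ : ∀ {n} {j v : Fin n} {Y} → v ∈ Y → collapse j Y v ≡ v
  collapse-∈ {v = v} {Y} v∈Y = cong (if_then v else _) (dec-true (v ∈? Y) v∈Y)

  collapse-∉ : ∀ {n} {j v : Fin n} {Y} → v ∉ Y → collapse j Y v ≡ j
  collapse-∉ {v = v} {Y} v∉Y = cong (if_then v else _) (dec-false (v ∈? Y) v∉Y)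

  merge : ∀ {n} → Fin n → Fin n → Fin n → Fin n
  merge i j v = if does (v ≟ i) then j else v

  merge-≡ : ∀ {n} (i j : Fin n) → merge i j i ≡ j
  merge-≡ i j = cong (if_then j else i) (dec-true (i ≟ i) ≡.refl)

  merge-≢ : ∀ {n} {i j v : Fin n} → v ≢ i → merge i j v ≡ v
  merge-≢ {v = v} v≢i = cong (if_then _ else v) (dec-false (v ≟ _) v≢i)

  collapse-merge-∉ : ∀ {n} {i j a : Fin n} {Y} → j ∉ Y → a ∉ Y ─ ⁅ i ⁆ → collapse j Y (merge i j a) ≡ j
  collapse-merge-∉ {i = i} {a = a} j∉Y a∉Y─i with a ≟ i
  ... | yes ≡.refl = collapse-∉ j∉Y
  ... | no  a≢i    = collapse-∉ λ a∈Y → a∉Y─i (x∈p∧x≢y⇒x∈p-y a∈Y a≢i)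

  support : ∀ {n} → Vec ℕ n → Subset n
  support []           = []
  support (zero  ∷ xs) = outside ∷ support xs
  support (suc _ ∷ xs) = inside ∷ support xs

  ∈-support : ∀ {n} (xs : Vec ℕ n) {u} → lookup xs u ≢ 0 → u ∈ support xs
  ∈-support (zero  ∷ xs) {zero}  x≢0  = contradiction ≡.refl x≢0
  ∈-support (suc _ ∷ xs) {zero}  _    = here
  ∈-support (zero  ∷ xs) {suc u} xᵤ≢0 = there (∈-support xs xᵤ≢0)
  ∈-support (suc _ ∷ xs) {suc u} xᵤ≢0 = there (∈-support xs xᵤ≢0)

  ∣support∣≤sum : ∀ {n} (xs : Vec ℕ n) → ∣ support xs ∣ ≤ Vec.sum xs
  ∣support∣≤sum []           = z≤n
  ∣support∣≤sum (zero  ∷ xs) = ∣support∣≤sum xs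
  ∣support∣≤sum (suc x ∷ xs) = s≤s (ℕ.≤-trans (∣support∣≤sum xs) (ℕ.m≤n+m _ x))

  x∉p─⁅x⁆ : ∀ {n} (p : Subset n) {x} → x ∉ p ─ ⁅ x ⁆
  x∉p─⁅x⁆ (_ ∷ p) {zero}  ()
  x∉p─⁅x⁆ (_ ∷ p) {suc x} (there x∈p─⁅x⁆) = x∉p─⁅x⁆ p x∈p─⁅x⁆

  collapse-preimage-< : ∀ {n} {j : Fin n} {Y} {xs ys : Vec ℕ n} → j ∉ Y →
                        renameᵐ (collapse j Y) xs ≡ ys → xs ≢ ys → lookup xs j < lookup ys j
  collapse-preimage-< {n} {j} {Y} {xs} {ys} j∉Y cxs≡ys xs≢ys =
    ≡.subst (lookup xs j <_) (≡.sym ysⱼ≡xsⱼ+r) (ℕ.m<m+n (lookup xs j) (ℕ.n≢0⇒n>0 r≢0))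
    where
    c : Fin n → Fin n
    c = collapse j Y
    t : Fin n → ℕ
    t u = δ (c u) j * lookup xs u
    r : ℕ
    r = ∑[ u < n ] (if does (j ≟ u) then 0 else t u)
    t-outside : ∀ {u} → u ∉ Y → t u ≡ lookup xs u
    t-outside {u} u∉Y = begin
      δ (c u) j * lookup xs u  ≡⟨ cong (λ w → δ w j * lookup xs u) (collapse-∉ u∉Y) ⟩
      δ j j * lookup xs u      ≡⟨ cong (_* lookup xs u) (δ-refl j) ⟩
      1 * lookup xs u          ≡⟨ ℕ.*-identityˡ (lookup xs u) ⟩
      lookup xs u              ∎
    ysⱼ≡xsⱼ+r : lookup ys j ≡ lookup xs j + r
    ysⱼ≡xsⱼ+r = begin
      lookup ys j              ≡⟨ cong (λ zs → lookup zs j) cxs≡ys ⟨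
      lookup (renameᵐ c xs) j  ≡⟨ lookup-renameᵐ c xs j ⟩
      sum t                    ≡⟨ ∑-isolate t j ⟩
      t j + r                  ≡⟨ cong (_+ r) (t-outside j∉Y) ⟩
      lookup xs j + r          ∎
    r≢0 : r ≢ 0
    r≢0 r≡0 = xs≢ys (≡.trans (≡.sym (renameᵐ-fixes c xs fixed)) cxs≡ys)
      where
      fixed : ∀ u → lookup xs u ≢ 0 → c u ≡ u
      fixed u xsᵤ≢0 with u ∈? Y | u ≟ j
      ... | yes _  | _       = ≡.refl
      ... | no _   | yes u≡j = ≡.sym u≡j
      ... | no u∉Y | no u≢j  = contradiction xsᵤ≡0 xsᵤ≢0
        where
        xsᵤ≡0 : lookup xs u ≡ 0
        xsᵤ≡0 = begin
          lookup xs u                        ≡⟨ t-outside u∉Y ⟨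
          t u                                ≡⟨ cong (if_then 0 else t u) (dec-false (j ≟ u) (≢-sym u≢j)) ⟨
          (if does (j ≟ u) then 0 else t u)  ≡⟨ ∑≡0⇒≡0 _ r≡0 u ⟩
          0                                  ∎

  lower : ∀ {n} → Fin n → Vec ℕ n → Vec ℕ n
  lower i xs = Vec.updateAt xs i ℕ.pred

  unit-+-lower : ∀ {n} {i : Fin n} {xs s} → lookup xs i ≡ suc s → unit i +ᵐ lower i xs ≡ xs
  unit-+-lower {i = i} {xs} {s} xsᵢ≡1+s = lookup-ext pointwise
    where
    pointwise : ∀ v → lookup (unit i +ᵐ lower i xs) v ≡ lookup xs v
    pointwise v with v ≟ i
    ... | yes ≡.refl = begin
      lookup (unit v +ᵐ lower v xs) v              ≡⟨ lookup-zipWith _+_ v (unit v) (lower v xs) ⟩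
      lookup (unit v) v + lookup (lower v xs) v    ≡⟨ cong₂ _+_ (≡.trans (lookup-unit v v) (δ-refl v))
                                                                (lookup∘updateAt v xs) ⟩
      suc (ℕ.pred (lookup xs v))                   ≡⟨ cong (λ x → suc (ℕ.pred x)) xsᵢ≡1+s ⟩
      suc s                                        ≡⟨ xsᵢ≡1+s ⟨
      lookup xs v                                  ∎
    ... | no v≢i = begin
      lookup (unit i +ᵐ lower i xs) v              ≡⟨ lookup-zipWith _+_ v (unit i) (lower i xs) ⟩
      lookup (unit i) v + lookup (lower i xs) v    ≡⟨ cong₂ _+_ (≡.trans (lookup-unit i v) (δ-≢ (≢-sym v≢i)))
                                                                (lookup∘updateAt′ v i v≢i xs) ⟩
      lookup xs v                                  ∎

  lookup-unit-+-lower : ∀ {n} {i j : Fin n} → j ≢ i → ∀ xs →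
                        lookup (unit j +ᵐ lower i xs) i ≡ ℕ.pred (lookup xs i)
  lookup-unit-+-lower {i = i} {j} j≢i xs = begin
    lookup (unit j +ᵐ lower i xs) i            ≡⟨ lookup-zipWith _+_ i (unit j) (lower i xs) ⟩
    lookup (unit j) i + lookup (lower i xs) i  ≡⟨ cong₂ _+_ (≡.trans (lookup-unit j i) (δ-≢ j≢i))
                                                            (lookup∘updateAt i xs) ⟩
    ℕ.pred (lookup xs i)                       ∎

  renameᵐ-merge-unit-+-lower : ∀ {n} {i j : Fin n} {xs s} → j ≢ i → lookup xs i ≡ suc s →
                               renameᵐ (merge i j) (unit j +ᵐ lower i xs) ≡ renameᵐ (merge i j) xs
  renameᵐ-merge-unit-+-lower {i = i} {j} {xs} j≢i xsᵢ≡1+s = begin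
    renameᵐ σ (unit j +ᵐ lower i xs)      ≡⟨ renameᵐ-unit-+ σ j (lower i xs) ⟩
    unit (σ j) +ᵐ renameᵐ σ (lower i xs)  ≡⟨ cong (λ v → unit v +ᵐ renameᵐ σ (lower i xs)) σj≡σi ⟩
    unit (σ i) +ᵐ renameᵐ σ (lower i xs)  ≡⟨ renameᵐ-unit-+ σ i (lower i xs) ⟨
    renameᵐ σ (unit i +ᵐ lower i xs)      ≡⟨ cong (renameᵐ σ) (unit-+-lower xsᵢ≡1+s) ⟩
    renameᵐ σ xs                          ∎
    where
    σ : Fin _ → Fin _
    σ = merge i j
    σj≡σi : σ j ≡ σ i
    σj≡σi = ≡.trans (merge-≢ j≢i) (≡.sym (merge-≡ i j))

  renameᵐ-merge-fixes : ∀ {n} {i j : Fin n} {xs} → lookup xs i ≡ 0 → renameᵐ (merge i j) xs ≡ xs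
  renameᵐ-merge-fixes {xs = xs} xsᵢ≡0 =
    renameᵐ-fixes _ xs λ u xsᵤ≢0 → merge-≢ λ u≡i → xsᵤ≢0 (≡.trans (cong (lookup xs) u≡i) xsᵢ≡0)

open Exponents

module Polynomials {ℓ₁ ℓ₂} (𝕂 : Field ℓ₁ ℓ₂) (n : ℕ) where
  open Field 𝕂
  open Poly 𝕂 n
  open import Algebra.Properties.Ring ring using (-0#≈0#; -‿+-comm; -1*x≈-x)
  open import Algebra.Properties.Group +-group using (x∙y⁻¹≈ε⇒x≈y; x≈y⇒x∙y⁻¹≈ε; //-rightDividesʳ)
  open import Algebra.Properties.CommutativeSemigroup +-commutativeSemigroup using (interchange; x∙yz≈y∙xz)
  open import Relation.Binary.Reasoning.Setoid setoid

  private
    variable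
      P : Pred Monomial 0ℓ

  infix 4 _≟ᵐ_
  _≟ᵐ_ : DecidableEquality Monomial
  _≟ᵐ_ = ≡-dec ℕ._≟_

  rename : (Fin n → Fin n) → Poly → Poly
  rename π = List.map (Product.map₂ (renameᵐ π))

  term : Decidable P → Carrier × Monomial → Carrier
  term P? (a , m) = if does (P? m) then a else 0#

  -- The sum of the coefficients of the monomials in P; coeff f m is the case P = (_≡ m),
  -- and the coefficients of rename π f and of (x_a − x_b) · h are again such sums over f and h.
  coeffSum : Decidable P → Poly → Carrier
  coeffSum P? []      = 0#
  coeffSum P? (t ∷ f) = term P? t + coeffSum P? f

  coeff≈coeffSum : ∀ f m → coeff f m ≈ coeffSum (_≟ᵐ m) f
  coeff≈coeffSum []             m = refl
  coeff≈coeffSum ((a , m') ∷ f) m with m' ≟ᵐ m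
  ... | yes _ = +-congˡ (coeff≈coeffSum f m)
  ... | no  _ = trans (coeff≈coeffSum f m) (sym (+-identityˡ _))

  coeff-∷-≡ : ∀ a m f → coeff ((a , m) ∷ f) m ≡ a + coeff f m
  coeff-∷-≡ a m f with m ≟ᵐ m
  ... | yes _   = ≡.refl
  ... | no  m≢m = contradiction ≡.refl m≢m

  coeff-∷-≢ : ∀ {a m' m} f → m' ≢ m → coeff ((a , m') ∷ f) m ≡ coeff f m
  coeff-∷-≢ {m' = m'} {m} f m'≢m with m' ≟ᵐ m
  ... | yes m'≡m = contradiction m'≡m m'≢m
  ... | no  _    = ≡.refl

  module _ (P? : Decidable P) where

    coeffSum-++ : ∀ f g → coeffSum P? (f ++ g) ≈ coeffSum P? f + coeffSum P? g
    coeffSum-++ []      g = sym (+-identityˡ _)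
    coeffSum-++ (t ∷ f) g = trans (+-congˡ (coeffSum-++ f g)) (sym (+-assoc _ _ _))

    coeffSum-neg : ∀ f → coeffSum P? (-ₚ f) ≈ - coeffSum P? f
    coeffSum-neg []            = sym -0#≈0#
    coeffSum-neg ((a , m) ∷ f) = trans (+-cong (if-neg (does (P? m))) (coeffSum-neg f)) (-‿+-comm _ _)
      where
      if-neg : ∀ b → (if b then - a else 0#) ≈ - (if b then a else 0#)
      if-neg true  = refl
      if-neg false = sym -0#≈0#

    coeffSum--ₚ : ∀ f g → coeffSum P? (f -ₚ g) ≈ coeffSum P? f - coeffSum P? g
    coeffSum--ₚ f g = trans (coeffSum-++ f (-ₚ g)) (+-congˡ (coeffSum-neg g))

    coeffSum-cong : ∀ {Q} (Q? : Decidable Q) → P ≐ Q → ∀ f → coeffSum P? f ≡ coeffSum Q? f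
    coeffSum-cong Q? P≐Q               []            = ≡.refl
    coeffSum-cong Q? P≐Q@(P⊆Q , Q⊆P) ((a , m) ∷ f) =
      cong₂ _+_ (cong (if_then a else 0#) (does-⇔ (mk⇔ P⊆Q Q⊆P) (P? m) (Q? m))) (coeffSum-cong Q? P≐Q f)

    coeffSum-split : ∀ {Q} (Q? : Decidable Q) f →
                     coeffSum P? f ≈ coeffSum (P? ∩? Q?) f + coeffSum (P? ∩? ∁? Q?) f
    coeffSum-split Q? []            = sym (+-identityˡ 0#)
    coeffSum-split Q? ((a , m) ∷ f) =
      trans (+-cong (if-split (does (P? m)) (does (Q? m))) (coeffSum-split Q? f)) (interchange _ _ _ _)
      where
      if-split : ∀ p q → (if p then a else 0#) ≈ (if p ∧ q then a else 0#) + (if p ∧ not q then a else 0#)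
      if-split true  true  = sym (+-identityʳ a)
      if-split true  false = sym (+-identityˡ a)
      if-split false _     = sym (+-identityˡ 0#)

  coeff--ₚ : ∀ f g m → coeff (f -ₚ g) m ≈ coeff f m - coeff g m
  coeff--ₚ f g m = begin
    coeff (f -ₚ g) m
      ≈⟨ coeff≈coeffSum (f -ₚ g) m ⟩
    coeffSum (_≟ᵐ m) (f -ₚ g)
      ≈⟨ coeffSum--ₚ (_≟ᵐ m) f g ⟩
    coeffSum (_≟ᵐ m) f - coeffSum (_≟ᵐ m) g
      ≈⟨ +-cong (coeff≈coeffSum f m) (-‿cong (coeff≈coeffSum g m)) ⟨
    coeff f m - coeff g m
      ∎

  coeffSum-vanish : ∀ (P? : Decidable P) f → (∀ {m} → P m → coeff f m ≈ 0#) → coeffSum P? f ≈ 0#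
  coeffSum-vanish P? []             _   = refl
  coeffSum-vanish {P} P? ((a , m₀) ∷ f) f≈0 with P? m₀
  ... | no ¬Pm₀ = trans (+-identityˡ _) (coeffSum-vanish P? f λ Pm →
                    trans (reflexive (≡.sym (coeff-∷-≢ f λ m₀≡m → ¬Pm₀ (≡.subst P (≡.sym m₀≡m) Pm))))
                          (f≈0 Pm))
  ... | yes Pm₀ = begin
    a + coeffSum P? f
      ≈⟨ +-congˡ (coeffSum-split P? (_≟ᵐ m₀) f) ⟩
    a + (coeffSum (P? ∩? (_≟ᵐ m₀)) f + coeffSum (P? ∩? ∁? (_≟ᵐ m₀)) f)
      ≈⟨ +-congˡ (+-cong (reflexive (coeffSum-cong (P? ∩? (_≟ᵐ m₀)) (_≟ᵐ m₀) at-m₀ f))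
                         (coeffSum-vanish (P? ∩? ∁? (_≟ᵐ m₀)) f away-from-m₀)) ⟩
    a + (coeffSum (_≟ᵐ m₀) f + 0#)
      ≈⟨ +-congˡ (trans (+-identityʳ _) (sym (coeff≈coeffSum f m₀))) ⟩
    a + coeff f m₀
      ≡⟨ coeff-∷-≡ a m₀ f ⟨
    coeff ((a , m₀) ∷ f) m₀
      ≈⟨ f≈0 Pm₀ ⟩
    0#
      ∎
    where
    at-m₀ : (P ∩ (_≡ m₀)) ≐ (_≡ m₀)
    at-m₀ = Product.proj₂ , λ m≡m₀ → ≡.subst P (≡.sym m≡m₀) Pm₀ , m≡m₀
    away-from-m₀ : ∀ {m} → P m × m ≢ m₀ → coeff f m ≈ 0#
    away-from-m₀ (Pm , m≢m₀) = trans (reflexive (≡.sym (coeff-∷-≢ f (≢-sym m≢m₀)))) (f≈0 Pm)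

  coeffSum-resp-≈ₚ : ∀ (P? : Decidable P) f g → f ≈ₚ g → coeffSum P? f ≈ coeffSum P? g
  coeffSum-resp-≈ₚ {P} P? f g f≈g = x∙y⁻¹≈ε⇒x≈y _ _ (begin
    coeffSum P? f - coeffSum P? g  ≈⟨ coeffSum--ₚ P? f g ⟨
    coeffSum P? (f -ₚ g)           ≈⟨ coeffSum-vanish P? (f -ₚ g) f-g≈0 ⟩
    0#                             ∎)
    where
    f-g≈0 : ∀ {m} → P m → coeff (f -ₚ g) m ≈ 0#
    f-g≈0 {m} _ = trans (coeff--ₚ f g m) (x≈y⇒x∙y⁻¹≈ε (f≈g m))

  coeffSum-rename : ∀ (P? : Decidable P) π f → coeffSum P? (rename π f) ≡ coeffSum (P? ∘ renameᵐ π) f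
  coeffSum-rename P? π []      = ≡.refl
  coeffSum-rename P? π (t ∷ f) = cong (_ +_) (coeffSum-rename P? π f)

  coeff-rename : ∀ π f m → coeff (rename π f) m ≈ coeffSum (λ m' → renameᵐ π m' ≟ᵐ m) f
  coeff-rename π f m = trans (coeff≈coeffSum (rename π f) m) (reflexive (coeffSum-rename (_≟ᵐ m) π f))

  -- Defs builds var a from an indicator function local to its definition, so the two
  -- exponent vectors are compared entrywise after the same case split on a ≟ v.
  var≡ : ∀ a → var a ≡ (1# , unit a) ∷ []
  var≡ a = cong (λ m → (1# , m) ∷ []) (lookup-ext exponent≗unit)
    where
    exponent : Poly → Monomial
    exponent []            = unit a
    exponent ((_ , m) ∷ _) = m
    exponent≗unit : ∀ v → lookup (exponent (var a)) v ≡ lookup (unit a) v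
    exponent≗unit v with a ≟ v | (lookup (exponent (var a)) v ≡ _) ∋ lookup∘tabulate _ v | lookup-unit a v
    ... | yes _ | exponent≡1 | unit≡1 = ≡.trans exponent≡1 (≡.sym unit≡1)
    ... | no  _ | exponent≡0 | unit≡0 = ≡.trans exponent≡0 (≡.sym unit≡0)

  -- φ is abstracted because the term map inside Defs' _*ₚ_ is a pattern lambda that is
  -- not definitionally equal to any function written here.
  coeffSum-scale-shift : ∀ (P? : Decidable P) x e (φ : Carrier × Monomial → Carrier × Monomial) →
                         (∀ b m → φ (b , m) ≡ (x * b , e +ᵐ m)) →
                         ∀ h → coeffSum P? (List.map φ h) ≈ x * coeffSum (P? ∘ (e +ᵐ_)) h
  coeffSum-scale-shift P? x e φ φ≡ []            = sym (zeroʳ x)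
  coeffSum-scale-shift P? x e φ φ≡ ((b , m) ∷ h) rewrite φ≡ b m =
    trans (+-cong (if-* (does (P? (e +ᵐ m)))) (coeffSum-scale-shift P? x e φ φ≡ h)) (sym (distribˡ x _ _))
    where
    if-* : ∀ t → (if t then x * b else 0#) ≈ x * (if t then b else 0#)
    if-* true  = refl
    if-* false = sym (zeroʳ x)

  coeffSum-linear : ∀ (P? : Decidable P) a b h →
                    coeffSum P? ((var a -ₚ var b) *ₚ h) ≈
                    coeffSum (P? ∘ (unit a +ᵐ_)) h - coeffSum (P? ∘ (unit b +ᵐ_)) h
  coeffSum-linear P? a b h = begin
    coeffSum P? ((var a -ₚ var b) *ₚ h)
      ≡⟨ cong₂ (λ p q → coeffSum P? ((p -ₚ q) *ₚ h)) (var≡ a) (var≡ b) ⟩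
    coeffSum P? (List.map _ h ++ (List.map _ h ++ []))
      ≈⟨ coeffSum-++ P? (List.map _ h) _ ⟩
    coeffSum P? (List.map _ h) + coeffSum P? (List.map _ h ++ [])
      ≈⟨ +-cong (coeffSum-scale-shift P? 1# (unit a) _ (λ _ _ → ≡.refl) h)
                (trans (coeffSum-++ P? (List.map _ h) []) (+-identityʳ _)) ⟩
    1# * A + coeffSum P? (List.map _ h)
      ≈⟨ +-cong (*-identityˡ A)
                (trans (coeffSum-scale-shift P? (- 1#) (unit b) _ (λ _ _ → ≡.refl) h) (-1*x≈-x B)) ⟩
    A - B
      ∎
    where
    A B : Carrier
    A = coeffSum (P? ∘ (unit a +ᵐ_)) h
    B = coeffSum (P? ∘ (unit b +ᵐ_)) h

  ∣⇒coeffSum≈0 : ∀ (P? : Decidable P) {a b} f →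
                 (P ∘ (unit a +ᵐ_)) ≐ (P ∘ (unit b +ᵐ_)) → (var a -ₚ var b) ∣ₚ f → coeffSum P? f ≈ 0#
  ∣⇒coeffSum≈0 {P} P? {a} {b} f exchange (h , f≈) = begin
    coeffSum P? f                        ≈⟨ coeffSum-resp-≈ₚ P? f ((var a -ₚ var b) *ₚ h) f≈ ⟩
    coeffSum P? ((var a -ₚ var b) *ₚ h)  ≈⟨ coeffSum-linear P? a b h ⟩
    coeffSum Pᵃ? h - coeffSum Pᵇ? h      ≡⟨ cong (_- coeffSum Pᵇ? h) (coeffSum-cong Pᵃ? Pᵇ? exchange h) ⟩
    coeffSum Pᵇ? h - coeffSum Pᵇ? h      ≈⟨ -‿inverseʳ _ ⟩
    0#                                   ∎
    where
    Pᵃ? : Decidable (P ∘ (unit a +ᵐ_))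
    Pᵃ? = P? ∘ (unit a +ᵐ_)
    Pᵇ? : Decidable (P ∘ (unit b +ᵐ_))
    Pᵇ? = P? ∘ (unit b +ᵐ_)

  homogeneous--ₚ : ∀ {d} f g → HomogeneousPoly d f → HomogeneousPoly d g → HomogeneousPoly d (f -ₚ g)
  homogeneous--ₚ f g f-hom g-hom m deg≢d = begin
    coeff (f -ₚ g) m       ≈⟨ coeff--ₚ f g m ⟩
    coeff f m - coeff g m  ≈⟨ +-cong (f-hom m deg≢d) (-‿cong (g-hom m deg≢d)) ⟩
    0# - 0#                ≈⟨ -‿inverseʳ 0# ⟩
    0#                     ∎

  homogeneous-rename : ∀ {d} π f → HomogeneousPoly d f → HomogeneousPoly d (rename π f)
  homogeneous-rename π f f-hom m deg≢d =
    trans (coeff-rename π f m) (coeffSum-vanish _ f λ {m'} πm'≡m →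
      f-hom m' λ deg≡d → deg≢d (≡.trans (≡.trans (cong degree (≡.sym πm'≡m)) (sum-renameᵐ π m')) deg≡d))

  module _ {i j : Fin n} (i≢j : i ≢ j) where

    -- x_i^s x_j^r x^b − x_j^(s+r) x^b = (x_i − x_j) · Σ_(t<s) x_i^t x_j^(s−1−t+r) x^b,
    -- generated by peeling off one factor x_i at a time.
    quotientTerm : ℕ → Carrier → Monomial → Poly
    quotientTerm zero    a m = []
    quotientTerm (suc s) a m = (a , lower i m) ∷ quotientTerm s a (unit j +ᵐ lower i m)

    quotient : Poly → Poly
    quotient []            = []
    quotient ((a , m) ∷ f) = quotientTerm (lookup m i) a m ++ quotient f

    module _ (P? : Decidable P) where

      private
        Pⁱ? Pʲ? : Decidable (P ∘ (_ +ᵐ_))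
        Pⁱ? = P? ∘ (unit i +ᵐ_)
        Pʲ? = P? ∘ (unit j +ᵐ_)

      term-division : ∀ s a m → lookup m i ≡ s →
                      term P? (a , m) + coeffSum Pʲ? (quotientTerm s a m) ≈
                      term P? (a , renameᵐ (merge i j) m) + coeffSum Pⁱ? (quotientTerm s a m)
      term-division zero a m mᵢ≡0 =
        reflexive (cong (λ m' → term P? (a , m') + 0#) (≡.sym (renameᵐ-merge-fixes mᵢ≡0)))
      term-division (suc s) a m mᵢ≡1+s = begin
        X + (term P? (a , m') + B)                   ≈⟨ +-congˡ m'-division ⟩
        X + (Z + A)                                  ≈⟨ x∙yz≈y∙xz X Z A ⟩
        Z + (X + A)                                  ≡⟨ cong (λ m'' → Z + (term P? (a , m'') + A))
                                                             (unit-+-lower mᵢ≡1+s) ⟨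
        Z + (term P? (a , unit i +ᵐ lower i m) + A)  ∎
        where
        m' : Monomial
        m' = unit j +ᵐ lower i m
        X Z A B : Carrier
        X = term P? (a , m)
        Z = term P? (a , renameᵐ (merge i j) m)
        A = coeffSum Pⁱ? (quotientTerm s a m')
        B = coeffSum Pʲ? (quotientTerm s a m')
        m'ᵢ≡s : lookup m' i ≡ s
        m'ᵢ≡s = ≡.trans (lookup-unit-+-lower (≢-sym i≢j) m) (cong ℕ.pred mᵢ≡1+s)
        m'-division : term P? (a , m') + B ≈ Z + A
        m'-division = begin
          term P? (a , m') + B                      ≈⟨ term-division s a m' m'ᵢ≡s ⟩
          term P? (a , renameᵐ (merge i j) m') + A  ≡⟨ cong (λ m'' → term P? (a , m'') + A)
                                                            (renameᵐ-merge-unit-+-lower (≢-sym i≢j) mᵢ≡1+s) ⟩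
          Z + A                                     ∎

      division : ∀ f → coeffSum P? f + coeffSum Pʲ? (quotient f) ≈
                       coeffSum P? (rename (merge i j) f) + coeffSum Pⁱ? (quotient f)
      division []            = refl
      division ((a , m) ∷ f) = begin
        (X + S) + coeffSum Pʲ? (Qₘ ++ Q)               ≈⟨ +-congˡ (coeffSum-++ Pʲ? Qₘ Q) ⟩
        (X + S) + (coeffSum Pʲ? Qₘ + coeffSum Pʲ? Q)   ≈⟨ interchange X S _ _ ⟩
        (X + coeffSum Pʲ? Qₘ) + (S + coeffSum Pʲ? Q)   ≈⟨ +-cong (term-division _ a m ≡.refl) (division f) ⟩
        (Z + coeffSum Pⁱ? Qₘ) + (Sσ + coeffSum Pⁱ? Q)  ≈⟨ interchange Z _ Sσ _ ⟩
        (Z + Sσ) + (coeffSum Pⁱ? Qₘ + coeffSum Pⁱ? Q)  ≈⟨ +-congˡ (coeffSum-++ Pⁱ? Qₘ Q) ⟨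
        (Z + Sσ) + coeffSum Pⁱ? (Qₘ ++ Q)              ∎
        where
        X Z S Sσ : Carrier
        X  = term P? (a , m)
        Z  = term P? (a , renameᵐ (merge i j) m)
        S  = coeffSum P? f
        Sσ = coeffSum P? (rename (merge i j) f)
        Qₘ Q : Poly
        Qₘ = quotientTerm (lookup m i) a m
        Q  = quotient f

    rename-merge≈0⇒∣ : ∀ f → rename (merge i j) f ≈ₚ 0ₚ → (var i -ₚ var j) ∣ₚ f
    rename-merge≈0⇒∣ f σf≈0 = quotient f , pointwise
      where
      pointwise : ∀ m → coeff f m ≈ coeff ((var i -ₚ var j) *ₚ quotient f) m
      pointwise m = begin
        coeff f m
          ≈⟨ coeff≈coeffSum f m ⟩
        coeffSum (_≟ᵐ m) f
          ≈⟨ //-rightDividesʳ B (coeffSum (_≟ᵐ m) f) ⟨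
        (coeffSum (_≟ᵐ m) f + B) - B
          ≈⟨ +-congʳ (division (_≟ᵐ m) f) ⟩
        (coeffSum (_≟ᵐ m) (rename (merge i j) f) + A) - B
          ≈⟨ +-congʳ (+-congʳ (trans (sym (coeff≈coeffSum (rename (merge i j) f) m)) (σf≈0 m))) ⟩
        (0# + A) - B
          ≈⟨ +-congʳ (+-identityˡ A) ⟩
        A - B
          ≈⟨ coeffSum-linear (_≟ᵐ m) i j (quotient f) ⟨
        coeffSum (_≟ᵐ m) ((var i -ₚ var j) *ₚ quotient f)
          ≈⟨ coeff≈coeffSum ((var i -ₚ var j) *ₚ quotient f) m ⟨
        coeff ((var i -ₚ var j) *ₚ quotient f) m
          ∎
        where
        A B : Carrier
        A = coeffSum ((_≟ᵐ m) ∘ (unit i +ᵐ_)) (quotient f)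
        B = coeffSum ((_≟ᵐ m) ∘ (unit j +ᵐ_)) (quotient f)

  collapses≈0⇒≈0 : ∀ {p} j g → HomogeneousPoly p g →
                   (∀ Y → j ∉ Y → ∣ Y ∣ ≤ p → rename (collapse j Y) g ≈ₚ 0ₚ) → g ≈ₚ 0ₚ
  collapses≈0⇒≈0 {p} j g g-hom collapses≈0 m = vanishes (suc (lookup m j)) m (ℕ.n<1+n _)
    where
    vanishes : ∀ t m → lookup m j < t → coeff g m ≈ 0#
    vanishes (suc t) m mⱼ<1+t with degree m ℕ.≟ p
    ... | no  deg≢p = g-hom m deg≢p
    ... | yes deg≡p = begin
      coeff g m
        ≈⟨ coeff≈coeffSum g m ⟩
      coeffSum (_≟ᵐ m) g
        ≡⟨ coeffSum-cong (_≟ᵐ m) (P? ∩? (_≟ᵐ m)) only-m g ⟩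
      coeffSum (P? ∩? (_≟ᵐ m)) g
        ≈⟨ +-identityʳ _ ⟨
      coeffSum (P? ∩? (_≟ᵐ m)) g + 0#
        ≈⟨ +-congˡ (coeffSum-vanish (P? ∩? ∁? (_≟ᵐ m)) g others) ⟨
      coeffSum (P? ∩? (_≟ᵐ m)) g + coeffSum (P? ∩? ∁? (_≟ᵐ m)) g
        ≈⟨ coeffSum-split P? (_≟ᵐ m) g ⟨
      coeffSum P? g
        ≈⟨ coeff-rename c g m ⟨
      coeff (rename c g) m
        ≈⟨ collapses≈0 Y j∉Y ∣Y∣≤p m ⟩
      0#
        ∎
      where
      Y : Subset n
      Y = support m ─ ⁅ j ⁆
      c : Fin n → Fin n
      c = collapse j Y
      P? : Decidable (λ m' → renameᵐ c m' ≡ m)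
      P? m' = renameᵐ c m' ≟ᵐ m
      j∉Y : j ∉ Y
      j∉Y = x∉p─⁅x⁆ (support m)
      ∣Y∣≤p : ∣ Y ∣ ≤ p
      ∣Y∣≤p = ℕ.≤-trans (∣p─q∣≤∣p∣ (support m) ⁅ j ⁆)
                        (ℕ.≤-trans (∣support∣≤sum m) (ℕ.≤-reflexive deg≡p))
      c-fixes-m : renameᵐ c m ≡ m
      c-fixes-m = renameᵐ-fixes c m fixes
        where
        fixes : ∀ u → lookup m u ≢ 0 → c u ≡ u
        fixes u mᵤ≢0 with u ≟ j
        ... | yes ≡.refl = collapse-∉ j∉Y
        ... | no  u≢j    = collapse-∈ (x∈p∧x≢y⇒x∈p-y (∈-support m mᵤ≢0) u≢j)
      only-m : (_≡ m) ≐ (λ m' → renameᵐ c m' ≡ m × m' ≡ m)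
      only-m = (λ { ≡.refl → c-fixes-m , ≡.refl }) , Product.proj₂
      others : ∀ {m'} → renameᵐ c m' ≡ m × m' ≢ m → coeff g m' ≈ 0#
      others (cm'≡m , m'≢m) =
        vanishes t _ (ℕ.<-≤-trans (collapse-preimage-< j∉Y cm'≡m m'≢m) (ℕ.≤-pred mⱼ<1+t))

  start∉ : ∀ {G : Graph n} {X u v} → WalkAvoiding G X u v → u ∉ X
  start∉ (stay u∉X)     = u∉X
  start∉ (step u∉X _ _) = u∉X

  module _ {G : Graph n} (θ : Derivation) (θ∈D : InD G θ) {X : Subset n} (P? : Decidable P)
           (exchange : ∀ {a b} → a ∉ X → b ∉ X → (P ∘ (unit a +ᵐ_)) ≐ (P ∘ (unit b +ᵐ_))) where

    coeffSum-along-walk : ∀ {u v} → WalkAvoiding G X u v → coeffSum P? (θ u) ≈ coeffSum P? (θ v)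
    coeffSum-along-walk (stay _)                    = refl
    coeffSum-along-walk (step {u} {w} u∉X u~w w⇝v) = trans edge (coeffSum-along-walk w⇝v)
      where
      edge : coeffSum P? (θ u) ≈ coeffSum P? (θ w)
      edge = x∙y⁻¹≈ε⇒x≈y _ _ (begin
        coeffSum P? (θ u) - coeffSum P? (θ w)  ≈⟨ coeffSum--ₚ P? (θ u) (θ w) ⟨
        coeffSum P? (θ u -ₚ θ w)               ≈⟨ ∣⇒coeffSum≈0 P? (θ u -ₚ θ w) u≐w (θ∈D u w u~w) ⟩
        0#                                     ∎)
        where
        u≐w : (P ∘ (unit u +ᵐ_)) ≐ (P ∘ (unit w +ᵐ_))
        u≐w = exchange u∉X (start∉ w⇝v)

  rename-collapse-merge≈0 : ∀ {G} θ → InD G θ → ∀ {i j Y} →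
                            ConnectedAfterDeleting G (Y ─ ⁅ i ⁆) → j ∉ Y →
                            rename (collapse j Y) (rename (merge i j) (θ i -ₚ θ j)) ≈ₚ 0ₚ
  rename-collapse-merge≈0 {G} θ θ∈D {i} {j} {Y} connected j∉Y m = begin
    coeff (rename c (rename σ (θ i -ₚ θ j))) m
      ≈⟨ coeff-rename c (rename σ (θ i -ₚ θ j)) m ⟩
    coeffSum (λ m' → renameᵐ c m' ≟ᵐ m) (rename σ (θ i -ₚ θ j))
      ≡⟨ coeffSum-rename (λ m' → renameᵐ c m' ≟ᵐ m) σ (θ i -ₚ θ j) ⟩
    coeffSum P? (θ i -ₚ θ j)
      ≈⟨ coeffSum--ₚ P? (θ i) (θ j) ⟩
    coeffSum P? (θ i) - coeffSum P? (θ j)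
      ≈⟨ x≈y⇒x∙y⁻¹≈ε (coeffSum-along-walk θ θ∈D P? exchange i⇝j) ⟩
    0#
      ∎
    where
    c σ : Fin n → Fin n
    c = collapse j Y
    σ = merge i j
    F : Monomial → Monomial
    F = renameᵐ c ∘ renameᵐ σ
    P? : Decidable (λ m' → F m' ≡ m)
    P? m' = F m' ≟ᵐ m
    i⇝j : WalkAvoiding G (Y ─ ⁅ i ⁆) i j
    i⇝j = connected i j (x∉p─⁅x⁆ Y) (j∉Y ∘ p─q⊆p Y ⁅ i ⁆)
    F-unit : ∀ {a} → a ∉ Y ─ ⁅ i ⁆ → ∀ m' → F (unit a +ᵐ m') ≡ unit j +ᵐ F m'
    F-unit {a} a∉Y─i m' = ≡.trans (cong (renameᵐ c) (renameᵐ-unit-+ σ a m'))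
                          (≡.trans (renameᵐ-unit-+ c (σ a) (renameᵐ σ m'))
                                   (cong (λ v → unit v +ᵐ F m') (collapse-merge-∉ j∉Y a∉Y─i)))
    exchange : ∀ {a b} → a ∉ Y ─ ⁅ i ⁆ → b ∉ Y ─ ⁅ i ⁆ →
               ((_≡ m) ∘ F ∘ (unit a +ᵐ_)) ≐ ((_≡ m) ∘ F ∘ (unit b +ᵐ_))
    exchange a∉ b∉ = (λ {m'} → ≡.trans (≡.trans (F-unit b∉ m') (≡.sym (F-unit a∉ m'))))
                   , (λ {m'} → ≡.trans (≡.trans (F-unit a∉ m') (≡.sym (F-unit b∉ m'))))

proposition3p2 : {c ℓ' : Level} (𝕂 : Field c ℓ') (ℓ k : ℕ) → k ≥ 1 →
    (G : Graph ℓ) → KConnected k G →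
    ∀ (p : ℕ) → p < k → (θ : Poly.Derivation 𝕂 ℓ) → Poly.HomogeneousDer 𝕂 ℓ p θ →
    (Poly.InD 𝕂 ℓ G θ ⇔ Poly.InD 𝕂 ℓ (complete ℓ) θ)
proposition3p2 𝕂 ℓ k _ G (_ , connected) p p<k θ θ-hom = mk⇔ to from
  where
  open Poly 𝕂 ℓ
  open Polynomials 𝕂 ℓ
  to : InD G θ → InD (complete ℓ) θ
  to θ∈D i j i≢j = rename-merge≈0⇒∣ i≢j f merged≈0
    where
    f : Poly
    f = θ i -ₚ θ j
    merged-hom : HomogeneousPoly p (rename (merge i j) f)
    merged-hom = homogeneous-rename (merge i j) f (homogeneous--ₚ (θ i) (θ j) (θ-hom i) (θ-hom j))
    merged≈0 : rename (merge i j) f ≈ₚ 0ₚ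
    merged≈0 = collapses≈0⇒≈0 j (rename (merge i j) f) merged-hom λ Y j∉Y ∣Y∣≤p →
      let ∣Y─i∣<k = ℕ.≤-<-trans (∣p─q∣≤∣p∣ Y ⁅ i ⁆) (ℕ.≤-<-trans ∣Y∣≤p p<k)
      in  rename-collapse-merge≈0 θ θ∈D (connected (Y ─ ⁅ i ⁆) ∣Y─i∣<k) j∉Y
  from : InD (complete ℓ) θ → InD G θ
  from θ∈D i j i~j = θ∈D i j λ { ≡.refl → irreflexive G i~j }
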